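{- Let $G$ be a finite abelian group. For any positive odd integer $n$, $$\operatorname{aw}_u(G \times \mathbb{Z}_n, 3) = \operatorname{aw}_u(G,3) + \operatorname{aw}_u(\mathbb{Z}_n,3) - 2.$$
   Context: $\mathbb{Z}_n$ is the cyclic group $\{0,\dots,n-1\}$ under addition mod $n$. A $k$-term arithmetic progression ($k$-AP) in an abelian group $H$ is a sequence $a, a+d, \dots, a+(k-1)d$ with $a,d \in H$ (degenerate ones allowed). An $r$-coloring of $H$ is a function $c: H \to \{1,\dots,r\}$; it is exact if surjective. A $k$-AP is rainbow under $c$ if $c(a+id) \neq c(a+jd)$ for all $0 \le i < j \le k-1$. A coloring is unitary if some element of $H$ receives a color used on no other element. $\operatorname{aw}_u(H,k)$ is the smallest $r$ such that every exact unitary $r$-coloring of $H$ contains a rainbow $k$-AP; if $H$ has no $k$-AP, $\operatorname{aw}_u(H,k)=|H|+1$. -}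

module Defs where

open import Level using (0ℓ)
open import Data.Nat using (ℕ; zero; suc; _≤_; _<_; NonZero)
open import Data.Nat.DivMod using (_%_; m%n<n)
open import Data.Fin using (Fin; toℕ; fromℕ<) renaming (_<_ to _<ᶠ_)
open import Data.Product using (Σ; ∃; ∃-syntax; _×_; _,_)
open import Relation.Binary.PropositionalEquality using (_≡_; _≢_)
open import Relation.Nullary using (¬_)
open import Function.Bundles using (_↔_)
open import Algebra.Structures using (IsAbelianGroup)
import Data.Nat as ℕ

record FiniteAbelianGroup : Set₁ where
  field
    Carrier        : Set
    _∙_            : Carrier → Carrier → Carrier
    ε              : Carrier
    _⁻¹            : Carrier → Carrier
    isAbelianGroup : IsAbelianGroup _≡_ _∙_ ε _⁻¹
    finite         : ∃[ m ] (Carrier ↔ Fin m)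

-- The only data of a group that the notion aw_u depends on:
-- the underlying set and the addition.
record AddStr : Set₁ where
  field
    Carrier : Set
    _⊕_     : Carrier → Carrier → Carrier

toAddStr : FiniteAbelianGroup → AddStr
toAddStr G = record { Carrier = FiniteAbelianGroup.Carrier G ; _⊕_ = FiniteAbelianGroup._∙_ G }

_+ₙ_ : ∀ {n} .{{_ : NonZero n}} → Fin n → Fin n → Fin n
_+ₙ_ {n} x y = fromℕ< (m%n<n (toℕ x ℕ.+ toℕ y) n)

ℤ/ : (n : ℕ) .{{_ : NonZero n}} → AddStr
ℤ/ n = record { Carrier = Fin n ; _⊕_ = _+ₙ_ }

_×ᴬ_ : AddStr → AddStr → AddStr
H ×ᴬ K = record
  { Carrier = AddStr.Carrier H × AddStr.Carrier K
  ; _⊕_ = λ { (a , b) (c , d) → (AddStr._⊕_ H a c , AddStr._⊕_ K b d) } }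

module _ (H : AddStr) where
  open AddStr H

  apTerm : Carrier → Carrier → ℕ → Carrier
  apTerm a d zero    = a
  apTerm a d (suc i) = apTerm a d i ⊕ d

  Rainbow : ∀ {r} (k : ℕ) → (Carrier → Fin r) → Carrier → Carrier → Set
  Rainbow k c a d = ∀ (i j : Fin k) → i <ᶠ j → c (apTerm a d (toℕ i)) ≢ c (apTerm a d (toℕ j))

  HasRainbowAP : ∀ {r} (k : ℕ) → (Carrier → Fin r) → Set
  HasRainbowAP k c = ∃[ a ] ∃[ d ] Rainbow k c a d

  Exact : ∀ {r} → (Carrier → Fin r) → Set
  Exact {r} c = ∀ (y : Fin r) → ∃[ x ] c x ≡ y

  Unitary : ∀ {r} → (Carrier → Fin r) → Set
  Unitary c = ∃[ x ] (∀ y → c y ≡ c x → y ≡ x)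

  AllRainbow : ℕ → ℕ → Set
  AllRainbow k r = ∀ (c : Carrier → Fin r) → Exact c → Unitary c → HasRainbowAP k c

  AwU : ℕ → ℕ → Set
  AwU k r = 2 ≤ r × AllRainbow k r × (∀ s → 2 ≤ s → s < r → ¬ AllRainbow k s)

module Submission where

-- Call an exact unitary rainbow-free r-colouring of H an obstruction; translating it and
-- renaming colours we may assume the unitary element is 0 and has colour 0.  Then
-- aw_u(H,3) - 1 is the largest number of colours of an obstruction, so it suffices to
-- build obstructions of G × ℤ_n from those of the factors and conversely.
--
-- Product: given obstructions w_G of G with p + 1 colours and w_K of K with q + 1 colours,
-- colour (g , 0) by w_G g and (g , z), z ≠ 0, by p + w_K z.  As 2z = 0 forces z = 0 in K,
-- the K-coordinates of a 3-AP are either constant (the AP is then coloured by w_G or is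
-- monochromatic) or pairwise distinct (its projection is then rainbow for w_K).
--
-- Splitting: given an obstruction of G × K with p + q colours, either q + 1 of its colours
-- occur on the axis {0} × K, which then carries an obstruction of K, or p colours do not.
-- Each coset {g} × K meets at most one such colour: halving in K yields a 3-AP
-- (g , z₁), (0 , h), (-g , -z₂) whose middle term lies on the axis, and colours are
-- invariant under negation.  Colouring each coset by the colour it meets (0 for the axis)
-- thus gives an obstruction of G with p + 1 colours.

open import Defs
open import Level using (0ℓ)
open import Algebra.Bundles using (AbelianGroup; Group)
open import Algebra.Structures using (IsAbelianGroup)
open import Algebra.Consequences.Propositional using (comm∧idˡ⇒id; comm∧invʳ⇒inv)
open import Data.Nat using (ℕ; zero; suc; _+_; _*_; _∸_; _≤_; _<_; z≤n; s≤s; s≤s⁻¹; _⊓_; NonZero)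
open import Data.Nat.Properties
  using (≤-refl; ≤-reflexive; ≤-trans; ≤-antisym; <-≤-trans; _≤?_; ≰⇒>; ≮⇒≥; ≤∧≢⇒<; m<n⇒m<1+n; <⇒≤;
         +-comm; +-assoc; +-suc; *-distribʳ-+; m+n≡0⇒n≡0; 1+n≢0; m+[n∸m]≡n; m≤n⇒∃[o]m+o≡n;
         +-cancelˡ-≤; +-cancelʳ-≤; +-monoˡ-≤; m⊓n≤n; m≤n⇒m⊓n≡m; module ≤-Reasoning)
  renaming (_≟_ to _≟ℕ_)
open import Data.Nat.DivMod
  using (_%_; m%n<n; %-distribˡ-+; %-distribˡ-*; m%n%n≡m%n; m<n⇒m%n≡m; n%n≡0; [m+kn]%n≡m%n)
open import Data.Nat.Tactic.RingSolver using (solve-∀)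
open import Data.Fin using (Fin; toℕ; fromℕ<)
open import Data.Fin.Patterns using (0F; 1F; 2F)
open import Data.Fin.Properties using (toℕ-injective; toℕ-fromℕ<; toℕ<n; all?; any?)
  renaming (_<?_ to _<ᶠ?_; _≟_ to _≟ᶠ_)
import Data.Fin.Permutation as Perm
open Perm using (transpose; _⟨$⟩ʳ_; _⟨$⟩ˡ_)
open import Data.Product using (∃; _×_; _,_; proj₁; proj₂)
open import Data.Product.Properties using (≡-dec)
open import Data.Sum using (_⊎_; inj₁; inj₂; [_,_]′)
open import Data.Empty using (⊥-elim)
open import Function using (_∘_)
open import Function.Bundles using (_↔_; Inverse)
open import Function.Properties.Inverse using (↔⇒↣)
open import Relation.Binary.Definitions using (DecidableEquality)
open import Relation.Binary.PropositionalEquality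
open import Relation.Nullary using (¬_; Dec; yes; no; ¬?; contradiction)
open import Relation.Nullary.Decidable using (_→-dec_; decidable-stable; dec-true; map′; via-injection)
open import Relation.Unary using (Decidable)

Distinct₃ : {C : Set} → C → C → C → Set
Distinct₃ x y z = x ≢ y × x ≢ z × y ≢ z

distinct₃-map : {B C : Set} (f : B → C) {x y z : B} → Distinct₃ (f x) (f y) (f z) → Distinct₃ x y z
distinct₃-map f (x≢y , x≢z , y≢z) = x≢y ∘ cong f , x≢z ∘ cong f , y≢z ∘ cong f

¬distinct₃-Fin2 : {x y z : Fin 2} → ¬ Distinct₃ x y z
¬distinct₃-Fin2 {0F} {0F}      (x≢y , _)     = x≢y refl
¬distinct₃-Fin2 {1F} {1F}      (x≢y , _)     = x≢y refl
¬distinct₃-Fin2 {0F} {1F} {0F} (_ , x≢z , _) = x≢z refl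
¬distinct₃-Fin2 {0F} {1F} {1F} (_ , _ , y≢z) = y≢z refl
¬distinct₃-Fin2 {1F} {0F} {0F} (_ , _ , y≢z) = y≢z refl
¬distinct₃-Fin2 {1F} {0F} {1F} (_ , x≢z , _) = x≢z refl

count : {P : ℕ → Set} → Decidable P → ℕ → ℕ
count P? zero = 0
count P? (suc n) with P? n
... | yes _ = suc (count P? n)
... | no  _ = count P? n

count-complement : {P : ℕ → Set} (P? : Decidable P) → ∀ n → count P? n + count (¬? ∘ P?) n ≡ n
count-complement P? zero = refl
count-complement P? (suc n) with P? n
... | yes _ = cong suc (count-complement P? n)
... | no  _ = trans (+-suc (count P? n) _) (cong suc (count-complement P? n))

count-surjective : {P : ℕ → Set} (P? : Decidable P) → ∀ {i} n → i < count P? n →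
                   ∃ λ y → y < n × P y × count P? y ≡ i
count-surjective P? {i} (suc n) i<count with P? n
... | no  _ = let (y , y<n , Py , count-y≡i) = count-surjective P? n i<count
              in y , m<n⇒m<1+n y<n , Py , count-y≡i
... | yes Pn with i ≟ℕ count P? n
...   | yes refl = n , ≤-refl , Pn , refl
...   | no  i≢count =
        let (y , y<n , Py , count-y≡i) = count-surjective P? n (≤∧≢⇒< (s≤s⁻¹ i<count) i≢count)
        in y , m<n⇒m<1+n y<n , Py , count-y≡i

count≡0⇒≡0 : {P : ℕ → Set} (P? : Decidable P) → P 0 → ∀ {y} → count P? y ≡ 0 → y ≡ 0
count≡0⇒≡0 P? P0 {zero}  _ = refl
count≡0⇒≡0 P? P0 {suc y} count≡0 with P? y
count≡0⇒≡0 P? P0 {suc y} ()      | yes _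
count≡0⇒≡0 P? P0 {suc y} count≡0 | no ¬Py with refl ← count≡0⇒≡0 P? P0 {y} count≡0 =
  contradiction P0 ¬Py

-- Rainbow 3-APs as midpoint triples

module _ (A : AddStr) where
  open AddStr A

  Midpoint : Carrier → Carrier → Carrier → Set
  Midpoint x m y = m ⊕ m ≡ x ⊕ y

  RainbowFree : {C : Set} → (Carrier → C) → Set
  RainbowFree c = ∀ {x m y} → Midpoint x m y → ¬ Distinct₃ (c x) (c m) (c y)

  rainbowFree-ends : {c : Carrier → ℕ} → RainbowFree c → ∀ {x m y} → Midpoint x m y →
                     c x ≢ c m → c m ≢ c y → c x ≡ c y
  rainbowFree-ends {c} rainbowFree {x} {y = y} mid x≢m m≢y =
    decidable-stable (c x ≟ℕ c y) (λ x≢y → rainbowFree mid (x≢m , x≢y , m≢y))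

  module _ {r} (c : Carrier → Fin r) (a d : Carrier) where
    private
      term : ℕ → Fin r
      term i = c (apTerm A a d i)

    rainbow₃⇒distinct₃ : Rainbow A 3 c a d → Distinct₃ (term 0) (term 1) (term 2)
    rainbow₃⇒distinct₃ rainbow =
      rainbow 0F 1F (s≤s z≤n) , rainbow 0F 2F (s≤s z≤n) , rainbow 1F 2F (s≤s (s≤s z≤n))

    distinct₃⇒rainbow₃ : Distinct₃ (term 0) (term 1) (term 2) → Rainbow A 3 c a d
    distinct₃⇒rainbow₃ (t₀≢t₁ , _ , _) 0F 1F _ = t₀≢t₁
    distinct₃⇒rainbow₃ (_ , t₀≢t₂ , _) 0F 2F _ = t₀≢t₂
    distinct₃⇒rainbow₃ (_ , _ , t₁≢t₂) 1F 2F _ = t₁≢t₂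
    distinct₃⇒rainbow₃ _ 0F 0F ()
    distinct₃⇒rainbow₃ _ 1F 0F ()
    distinct₃⇒rainbow₃ _ 1F 1F (s≤s ())
    distinct₃⇒rainbow₃ _ 2F 0F ()
    distinct₃⇒rainbow₃ _ 2F 1F (s≤s ())
    distinct₃⇒rainbow₃ _ 2F 2F (s≤s (s≤s ()))

record SearchableAbelianGroup (A : AddStr) : Set₁ where
  open AddStr A
  field
    0#             : Carrier
    -_             : Carrier → Carrier
    isAbelianGroup : IsAbelianGroup _≡_ _⊕_ 0# -_
    _≟_            : DecidableEquality Carrier
    search         : ∀ {P : Carrier → Set} → Decidable P → Dec (∃ P)

module GroupTheory {A : AddStr} (𝔸 : SearchableAbelianGroup A) where
  open AddStr A public
  open SearchableAbelianGroup 𝔸 public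

  abelianGroup : AbelianGroup 0ℓ 0ℓ
  abelianGroup = record { isAbelianGroup = isAbelianGroup }

  open AbelianGroup abelianGroup public using (assoc; comm; identityˡ; inverseʳ)
  open Group (AbelianGroup.group abelianGroup) public using (_//_)
  open import Algebra.Properties.AbelianGroup abelianGroup public
    using (ε⁻¹≈ε; ⁻¹-injective; identityˡ-unique; //-rightDividesˡ; ∙-cancelˡ; xyx⁻¹≈y)
  open import Algebra.Properties.CommutativeSemigroup (AbelianGroup.commutativeSemigroup abelianGroup)
    using (interchange)
  open ≡-Reasoning

  x⊕[y//x]≡y : ∀ x y → x ⊕ (y // x) ≡ y
  x⊕[y//x]≡y x y = trans (comm x (y // x)) (//-rightDividesˡ x y)

  apTerm-midpoint : ∀ a d → Midpoint A (apTerm A a d 0) (apTerm A a d 1) (apTerm A a d 2)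
  apTerm-midpoint a d = begin
    (a ⊕ d) ⊕ (a ⊕ d) ≡⟨ assoc a d (a ⊕ d) ⟩
    a ⊕ (d ⊕ (a ⊕ d)) ≡⟨ cong (a ⊕_) (comm d (a ⊕ d)) ⟩
    a ⊕ ((a ⊕ d) ⊕ d) ∎

  midpoint⇒apTerm : ∀ {x m y} → Midpoint A x m y →
                    apTerm A x (m // x) 1 ≡ m × apTerm A x (m // x) 2 ≡ y
  midpoint⇒apTerm {x} {m} {y} mid = x⊕[y//x]≡y x m , (begin
    (x ⊕ (m // x)) ⊕ (m // x) ≡⟨ cong (_⊕ (m // x)) (x⊕[y//x]≡y x m) ⟩
    m ⊕ (m // x)              ≡⟨ assoc m m (- x) ⟨
    (m ⊕ m) // x              ≡⟨ cong (_// x) mid ⟩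
    (x ⊕ y) // x              ≡⟨ xyx⁻¹≈y x y ⟩
    y                         ∎)

  midpoint-⊕ʳ : ∀ {x m y} u → Midpoint A x m y → Midpoint A (x ⊕ u) (m ⊕ u) (y ⊕ u)
  midpoint-⊕ʳ {x} {m} {y} u mid = begin
    (m ⊕ u) ⊕ (m ⊕ u) ≡⟨ interchange m u m u ⟩
    (m ⊕ m) ⊕ (u ⊕ u) ≡⟨ cong (_⊕ (u ⊕ u)) mid ⟩
    (x ⊕ y) ⊕ (u ⊕ u) ≡⟨ interchange x y u u ⟩
    (x ⊕ u) ⊕ (y ⊕ u) ∎

  midpoint-constant : ∀ {x m y} → Midpoint A x m y → x ≡ m → m ≡ y
  midpoint-constant {m = m} mid refl = ∙-cancelˡ m m _ mid

  midpoint-distinct : (∀ {x y} → x ⊕ x ≡ y ⊕ y → x ≡ y) →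
                      ∀ {x m y} → Midpoint A x m y → x ≢ m → Distinct₃ x m y
  midpoint-distinct double-injective {x} {m} {y} mid x≢m =
    x≢m , (λ { refl → x≢m (sym (double-injective mid)) }) ,
    x≢m ∘ sym ∘ midpoint-constant (trans mid (comm x y)) ∘ sym

  module _ {r} (c : Carrier → Fin r) where

    rainbowAP⇒¬rainbowFree : HasRainbowAP A 3 c → ¬ RainbowFree A c
    rainbowAP⇒¬rainbowFree (a , d , rainbow) rainbowFree =
      rainbowFree (apTerm-midpoint a d) (rainbow₃⇒distinct₃ A c a d rainbow)

    ¬rainbowAP⇒rainbowFree : ¬ HasRainbowAP A 3 c → RainbowFree A c
    ¬rainbowAP⇒rainbowFree ¬rainbowAP {x} {m} {y} mid distinct =
      ¬rainbowAP (x , m // x , distinct₃⇒rainbow₃ A c x (m // x)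
        (subst₂ (λ m′ y′ → Distinct₃ (c x) (c m′) (c y′)) (sym term₁≡m) (sym term₂≡y) distinct))
      where
      term₁≡m = proj₁ (midpoint⇒apTerm mid)
      term₂≡y = proj₂ (midpoint⇒apTerm mid)

    hasRainbowAP? : Dec (HasRainbowAP A 3 c)
    hasRainbowAP? = search λ a → search λ d → all? λ i → all? λ j →
      (i <ᶠ? j) →-dec ¬? (c (apTerm A a d (toℕ i)) ≟ᶠ c (apTerm A a d (toℕ j)))

  -- An exact unitary rainbow-free colouring, translated so that its unitary element is 0#
  -- and recoloured so that this element has colour 0 (see normalise).  Only the colours
  -- below r must occur; larger ones are capped in obstruction⇒¬allRainbow.
  record Obstruction (r : ℕ) : Set where
    field
      colour       : Carrier → ℕ
      colour-0#    : colour 0# ≡ 0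
      colour≡0⇒≡0# : ∀ {x} → colour x ≡ 0 → x ≡ 0#
      colour-onto  : ∀ {t} → t < r → ∃ λ x → colour x ≡ t
      rainbowFree  : RainbowFree A colour

  obstruction-mono : ∀ {r s} → s ≤ r → Obstruction r → Obstruction s
  obstruction-mono s≤r O = record
    { colour = colour ; colour-0# = colour-0# ; colour≡0⇒≡0# = colour≡0⇒≡0#
    ; colour-onto = λ t<s → colour-onto (<-≤-trans t<s s≤r) ; rainbowFree = rainbowFree }
    where open Obstruction O

  module _ {r} (O : Obstruction r) where
    open Obstruction O

    obstruction-colour-neg : ∀ x → colour (- x) ≡ colour x
    obstruction-colour-neg x with colour x ≟ℕ 0
    ... | yes colour-x≡0 with refl ← colour≡0⇒≡0# colour-x≡0 = cong colour ε⁻¹≈ε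
    ... | no  colour-x≢0 = sym (rainbowFree-ends A rainbowFree x-0#-[-x] x≢0# 0#≢-x)
      where
      x-0#-[-x] : Midpoint A x 0# (- x)
      x-0#-[-x] = trans (identityˡ 0#) (sym (inverseʳ x))
      x≢0# : colour x ≢ colour 0#
      x≢0# colour-x≡ = colour-x≢0 (trans colour-x≡ colour-0#)
      0#≢-x : colour 0# ≢ colour (- x)
      0#≢-x colour-0#≡ = colour-x≢0 (trans (cong colour x≡0#) colour-0#)
        where
        x≡0# : x ≡ 0#
        x≡0# = ⁻¹-injective (trans (colour≡0⇒≡0# (trans (sym colour-0#≡) colour-0#)) (sym ε⁻¹≈ε))

  obstruction⇒¬allRainbow : ∀ {s} → Obstruction (suc (suc s)) → ¬ AllRainbow A 3 (suc (suc s))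
  obstruction⇒¬allRainbow {s} O allRainbow =
    rainbowAP⇒¬rainbowFree capped (allRainbow capped exact unitary)
                           (λ mid → rainbowFree mid ∘ distinct₃-map cap)
    where
    open Obstruction O
    cap : ℕ → Fin (suc (suc s))
    cap n = fromℕ< (s≤s (m⊓n≤n n (suc s)))
    capped : Carrier → Fin (suc (suc s))
    capped = cap ∘ colour
    exact : Exact A capped
    exact y = x , toℕ-injective (begin
      toℕ (cap (colour x)) ≡⟨ toℕ-fromℕ< _ ⟩
      colour x ⊓ suc s     ≡⟨ cong (_⊓ suc s) colour-x≡y ⟩
      toℕ y ⊓ suc s        ≡⟨ m≤n⇒m⊓n≡m (s≤s⁻¹ (toℕ<n y)) ⟩
      toℕ y                ∎)
      where
      x = proj₁ (colour-onto (toℕ<n y))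
      colour-x≡y = proj₂ (colour-onto (toℕ<n y))
    cap≡0⇒≡0 : ∀ n → cap n ≡ cap 0 → n ≡ 0
    cap≡0⇒≡0 zero    _  = refl
    cap≡0⇒≡0 (suc n) ()
    unitary : Unitary A capped
    unitary = 0# , λ y capped-y≡ →
      colour≡0⇒≡0# (cap≡0⇒≡0 (colour y) (trans capped-y≡ (cong cap colour-0#)))

  transpose-i≡j : ∀ {n} (i j : Fin n) → transpose i j ⟨$⟩ʳ i ≡ j
  transpose-i≡j i j rewrite dec-true (i ≟ᶠ i) refl = refl

  normalise : ∀ {r} (κ : Carrier → Fin r) → Exact A κ → Unitary A κ → ¬ HasRainbowAP A 3 κ →
              Obstruction r
  normalise {zero}  κ _ (u , _) _ with () ← κ u
  normalise {suc r} κ exact (u , unique) ¬rainbowAP = record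
    { colour = colour ; colour-0# = colour-0# ; colour≡0⇒≡0# = colour≡0⇒≡0#
    ; colour-onto = colour-onto ; rainbowFree = rainbowFree }
    where
    π = transpose (κ u) Fin.zero
    recolour : Fin (suc r) → ℕ
    recolour i = toℕ (π ⟨$⟩ʳ i)
    colour : Carrier → ℕ
    colour x = recolour (κ (x ⊕ u))
    colour-0# : colour 0# ≡ 0
    colour-0# = trans (cong (recolour ∘ κ) (identityˡ u)) (cong toℕ (transpose-i≡j (κ u) Fin.zero))
    colour≡0⇒≡0# : ∀ {x} → colour x ≡ 0 → x ≡ 0#
    colour≡0⇒≡0# {x} colour-x≡0 = identityˡ-unique x u (unique (x ⊕ u) (begin
      κ (x ⊕ u)                 ≡⟨ Perm.inverseˡ π ⟨
      π ⟨$⟩ˡ (π ⟨$⟩ʳ κ (x ⊕ u)) ≡⟨ cong (π ⟨$⟩ˡ_) (toℕ-injective colour-x≡0) ⟩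
      π ⟨$⟩ˡ Fin.zero           ≡⟨ cong (π ⟨$⟩ˡ_) (transpose-i≡j (κ u) Fin.zero) ⟨
      π ⟨$⟩ˡ (π ⟨$⟩ʳ κ u)       ≡⟨ Perm.inverseˡ π ⟩
      κ u                       ∎))
    colour-onto : ∀ {t} → t < suc r → ∃ λ x → colour x ≡ t
    colour-onto t<r = x // u , (begin
      recolour (κ ((x // u) ⊕ u))      ≡⟨ cong (recolour ∘ κ) (//-rightDividesˡ u x) ⟩
      recolour (κ x)                   ≡⟨ cong recolour κx≡ ⟩
      toℕ (π ⟨$⟩ʳ (π ⟨$⟩ˡ fromℕ< t<r)) ≡⟨ cong toℕ (Perm.inverseʳ π) ⟩
      toℕ (fromℕ< t<r)                 ≡⟨ toℕ-fromℕ< t<r ⟩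
      _                                ∎)
      where
      x = proj₁ (exact (π ⟨$⟩ˡ fromℕ< t<r))
      κx≡ = proj₂ (exact (π ⟨$⟩ˡ fromℕ< t<r))
    rainbowFree : RainbowFree A colour
    rainbowFree mid = ¬rainbowAP⇒rainbowFree κ ¬rainbowAP (midpoint-⊕ʳ u mid) ∘ distinct₃-map recolour

  ¬obstruction⇒allRainbow : ∀ {r} → ¬ Obstruction r → AllRainbow A 3 r
  ¬obstruction⇒allRainbow ¬O κ exact unitary =
    decidable-stable (hasRainbowAP? κ) (¬O ∘ normalise κ exact unitary)

  private
    isNonzero : Carrier → Fin 2
    isNonzero y with y ≟ 0#
    ... | yes _ = 0F
    ... | no  _ = 1F

    isNonzero-0# : isNonzero 0# ≡ 0F
    isNonzero-0# with 0# ≟ 0#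
    ... | yes _   = refl
    ... | no  0≢0 = contradiction refl 0≢0

    isNonzero-≢0# : ∀ {y} → y ≢ 0# → isNonzero y ≡ 1F
    isNonzero-≢0# {y} y≢0# with y ≟ 0#
    ... | yes y≡0# = contradiction y≡0# y≢0#
    ... | no  _    = refl

    isNonzero≡0⇒≡0# : ∀ y → isNonzero y ≡ 0F → y ≡ 0#
    isNonzero≡0⇒≡0# y _  with y ≟ 0#
    isNonzero≡0⇒≡0# y _  | yes y≡0# = y≡0#
    isNonzero≡0⇒≡0# y () | no  _

  allRainbow₂⇒trivial : AllRainbow A 3 2 → ∀ x → x ≡ 0#
  allRainbow₂⇒trivial allRainbow x with x ≟ 0#
  ... | yes x≡0# = x≡0#
  ... | no  x≢0# =
    ⊥-elim (rainbowAP⇒¬rainbowFree isNonzero (allRainbow isNonzero exact unitary) (λ _ → ¬distinct₃-Fin2))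
    where
    exact : Exact A isNonzero
    exact 0F = 0# , isNonzero-0#
    exact 1F = x , isNonzero-≢0# x≢0#
    unitary : Unitary A isNonzero
    unitary = 0# , λ y isNonzero-y≡ → isNonzero≡0⇒≡0# y (trans isNonzero-y≡ isNonzero-0#)

  trivial⇒obstruction₁ : (∀ x → x ≡ 0#) → Obstruction 1
  trivial⇒obstruction₁ trivial = record
    { colour = λ _ → 0 ; colour-0# = refl ; colour≡0⇒≡0# = λ {x} _ → trivial x
    ; colour-onto = λ { (s≤s z≤n) → 0# , refl } ; rainbowFree = λ _ distinct → proj₁ distinct refl }

  awU⇒¬¬obstruction : ∀ {r} → AwU A 3 (suc r) → ¬ ¬ Obstruction r
  awU⇒¬¬obstruction {zero}        (s≤s () , _)
  awU⇒¬¬obstruction {suc zero}    (_ , allRainbow₂ , _) ¬O =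
    ¬O (trivial⇒obstruction₁ (allRainbow₂⇒trivial allRainbow₂))
  awU⇒¬¬obstruction {suc (suc s)} (_ , _ , minimal) ¬O =
    minimal (suc (suc s)) (s≤s (s≤s z≤n)) ≤-refl (¬obstruction⇒allRainbow ¬O)

isAbelianGroup-≡ : {C : Set} {_∙_ : C → C → C} {e : C} {_⁻¹ : C → C} →
                   (∀ x y z → (x ∙ y) ∙ z ≡ x ∙ (y ∙ z)) → (∀ x y → x ∙ y ≡ y ∙ x) →
                   (∀ x → e ∙ x ≡ x) → (∀ x → x ∙ (x ⁻¹) ≡ e) → IsAbelianGroup _≡_ _∙_ e _⁻¹
isAbelianGroup-≡ {_∙_ = _∙_} {_⁻¹ = _⁻¹} assoc comm identityˡ inverseʳ = record
  { isGroup = record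
    { isMonoid = record
      { isSemigroup = record
        { isMagma = record { isEquivalence = isEquivalence ; ∙-cong = cong₂ _∙_ }
        ; assoc   = assoc }
      ; identity = comm∧idˡ⇒id comm identityˡ }
    ; inverse = comm∧invʳ⇒inv comm inverseʳ
    ; ⁻¹-cong = cong _⁻¹ }
  ; comm = comm }

finite⇒search : {C : Set} {k : ℕ} → C ↔ Fin k → ∀ {P : C → Set} → Decidable P → Dec (∃ P)
finite⇒search C↔Fin {P} P? =
  map′ (λ (i , p) → from i , p) (λ (x , px) → to x , subst P (sym (strictlyInverseʳ x)) px)
       (any? (P? ∘ from))
  where open Inverse C↔Fin

finiteAbelianGroup⇒searchable : (G : FiniteAbelianGroup) → SearchableAbelianGroup (toAddStr G)
finiteAbelianGroup⇒searchable G = record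
  { 0# = ε ; -_ = _⁻¹ ; isAbelianGroup = isAbelianGroup
  ; _≟_ = via-injection (↔⇒↣ (proj₂ finite)) _≟ᶠ_ ; search = finite⇒search (proj₂ finite) }
  where open FiniteAbelianGroup G

infixr 2 _×-searchable_
_×-searchable_ : ∀ {G K} → SearchableAbelianGroup G → SearchableAbelianGroup K →
                 SearchableAbelianGroup (G ×ᴬ K)
𝔾 ×-searchable 𝕂 = record
  { 0# = G.0# , K.0#
  ; -_ = λ (g , z) → G.- g , K.- z
  ; isAbelianGroup = isAbelianGroup-≡
      (λ _ _ _ → cong₂ _,_ (G.assoc _ _ _) (K.assoc _ _ _)) (λ _ _ → cong₂ _,_ (G.comm _ _) (K.comm _ _))
      (λ _ → cong₂ _,_ (G.identityˡ _) (K.identityˡ _)) (λ _ → cong₂ _,_ (G.inverseʳ _) (K.inverseʳ _))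
  ; _≟_ = ≡-dec G._≟_ K._≟_
  ; search = λ P? → map′ (λ (g , z , p) → (g , z) , p) (λ ((g , z) , p) → g , z , p)
                         (G.search λ g → K.search λ z → P? (g , z)) }
  where
  module G = GroupTheory 𝔾
  module K = GroupTheory 𝕂

-- Obstructions of a product

module _ {G K : AddStr} (𝔾 : SearchableAbelianGroup G) (𝕂 : SearchableAbelianGroup K) where
  private
    module G = GroupTheory 𝔾
    module K = GroupTheory 𝕂
    module H = GroupTheory (𝔾 ×-searchable 𝕂)

  module ProductObstruction (double-injective : ∀ {x y} → x K.⊕ x ≡ y K.⊕ y → x ≡ y)
                            {p q} (𝒢 : G.Obstruction (suc p)) (𝒦 : K.Obstruction (suc q)) where
    open G.Obstruction 𝒢 renaming (colour to wG; colour-0# to wG-0#; colour≡0⇒≡0# to wG≡0⇒≡0#;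
                                   colour-onto to wG-onto; rainbowFree to wG-rainbowFree)
    open K.Obstruction 𝒦 renaming (colour to wK; colour-0# to wK-0#; colour≡0⇒≡0# to wK≡0⇒≡0#;
                                   colour-onto to wK-onto; rainbowFree to wK-rainbowFree)

    colour : H.Carrier → ℕ
    colour (g , z) with z K.≟ K.0#
    ... | yes _ = wG g
    ... | no  _ = p + wK z

    colour-axis : ∀ g → colour (g , K.0#) ≡ wG g
    colour-axis g with K.0# K.≟ K.0#
    ... | yes _   = refl
    ... | no  0≢0 = contradiction refl 0≢0

    colour-off-axis : ∀ g {z} → z ≢ K.0# → colour (g , z) ≡ p + wK z
    colour-off-axis g {z} z≢0# with z K.≟ K.0#
    ... | yes z≡0# = contradiction z≡0# z≢0#
    ... | no  _    = refl

    colour≡0⇒≡0# : ∀ {x} → colour x ≡ 0 → x ≡ H.0#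
    colour≡0⇒≡0# {g , z} colour≡0 with z K.≟ K.0#
    ... | yes refl = cong (_, K.0#) (wG≡0⇒≡0# colour≡0)
    ... | no  z≢0# = contradiction (wK≡0⇒≡0# (m+n≡0⇒n≡0 p colour≡0)) z≢0#

    colour-onto : ∀ {t} → t < suc (p + q) → ∃ λ x → colour x ≡ t
    colour-onto {t} t<1+p+q with t ≤? p
    ... | yes t≤p = let (g , wG-g≡t) = wG-onto (s≤s t≤p) in (g , K.0#) , trans (colour-axis g) wG-g≡t
    ... | no  t≰p with s , refl ← m≤n⇒∃[o]m+o≡n (≰⇒> t≰p) =
      (G.0# , z) , trans (colour-off-axis G.0# z≢0#) (trans (cong (p +_) wK-z≡1+s) (+-suc p s))
      where
      1+s<1+q : suc s < suc q
      1+s<1+q = s≤s (+-cancelˡ-≤ p (suc s) q (≤-trans (≤-reflexive (+-suc p s)) (s≤s⁻¹ t<1+p+q)))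
      z = proj₁ (wK-onto 1+s<1+q)
      wK-z≡1+s = proj₂ (wK-onto 1+s<1+q)
      z≢0# : z ≢ K.0#
      z≢0# z≡0# = 1+n≢0 (trans (sym wK-z≡1+s) (trans (cong wK z≡0#) wK-0#))

    colour≢⇒wK≢ : ∀ {g g′ z z′} → z ≢ z′ → colour (g , z) ≢ colour (g′ , z′) → wK z ≢ wK z′
    colour≢⇒wK≢ {z = z} {z′} z≢z′ colours≢ with z K.≟ K.0# | z′ K.≟ K.0#
    ... | yes refl | yes refl = contradiction refl z≢z′
    ... | yes refl | no  z′≢0# = λ wK-0≡ → z′≢0# (wK≡0⇒≡0# (trans (sym wK-0≡) wK-0#))
    ... | no  z≢0# | yes refl  = λ wK-z≡ → z≢0# (wK≡0⇒≡0# (trans wK-z≡ wK-0#))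
    ... | no  _    | no  _     = colours≢ ∘ cong (p +_)

    rainbowFree : RainbowFree (G ×ᴬ K) colour
    rainbowFree {g₀ , z₀} {g₁ , z₁} {g₂ , z₂} mid distinct with z₀ K.≟ z₁
    ... | no z₀≢z₁ =
      let (z₀≢z₁ , z₀≢z₂ , z₁≢z₂) = K.midpoint-distinct double-injective (cong proj₂ mid) z₀≢z₁
          (c₀≢c₁ , c₀≢c₂ , c₁≢c₂) = distinct
      in wK-rainbowFree (cong proj₂ mid)
           (colour≢⇒wK≢ z₀≢z₁ c₀≢c₁ , colour≢⇒wK≢ z₀≢z₂ c₀≢c₂ , colour≢⇒wK≢ z₁≢z₂ c₁≢c₂)
    ... | yes refl with refl ← K.midpoint-constant (cong proj₂ mid) refl | z₀ K.≟ K.0#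
    ...   | yes refl = wG-rainbowFree (cong proj₁ mid) distinct
    ...   | no  _    = proj₁ distinct refl

    ×-obstruction : H.Obstruction (suc (p + q))
    ×-obstruction = record
      { colour = colour ; colour-0# = trans (colour-axis G.0#) wG-0# ; colour≡0⇒≡0# = colour≡0⇒≡0#
      ; colour-onto = colour-onto ; rainbowFree = rainbowFree }

  open ProductObstruction public using (×-obstruction)

  module ObstructionSplit (halve : ∀ z → ∃ λ h → h K.⊕ h ≡ z) {p q} (𝒪 : H.Obstruction (p + q)) where
    open H.Obstruction 𝒪

    KColour : ℕ → Set
    KColour y = ∃ λ z → colour (G.0# , z) ≡ y

    KColour? : Decidable KColour
    KColour? y = K.search λ z → colour (G.0# , z) ≟ℕ y

    axis-obstruction : suc q ≤ count KColour? (p + q) → K.Obstruction (suc q)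
    axis-obstruction 1+q≤count = record
      { colour = axisColour ; colour-0# = cong (count KColour?) colour-0#
      ; colour≡0⇒≡0# = cong proj₂ ∘ colour≡0⇒≡0# ∘ count≡0⇒≡0 KColour? (K.0# , colour-0#)
      ; colour-onto = onto ; rainbowFree = axis-rainbowFree }
      where
      axisColour : K.Carrier → ℕ
      axisColour z = count KColour? (colour (G.0# , z))
      onto : ∀ {t} → t < suc q → ∃ λ z → axisColour z ≡ t
      onto t<1+q =
        let (_ , _ , (z , colour-z≡y) , count-y≡t) =
              count-surjective KColour? (p + q) (<-≤-trans t<1+q 1+q≤count)
        in z , trans (cong (count KColour?) colour-z≡y) count-y≡t
      axis-rainbowFree : RainbowFree K axisColour
      axis-rainbowFree mid = rainbowFree (cong (G.0# G.⊕ G.0# ,_) mid) ∘ distinct₃-map (count KColour?)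

    coset-colour-unique : ∀ {g z₁ z₂} → ¬ KColour (colour (g , z₁)) → ¬ KColour (colour (g , z₂)) →
                          colour (g , z₁) ≡ colour (g , z₂)
    coset-colour-unique {g} {z₁} {z₂} ¬K₁ ¬K₂ =
      trans (rainbowFree-ends (G ×ᴬ K) rainbowFree mid (λ e → ¬K₁ (h , sym e)) (λ e → ¬K₂ (h , trans e y≡))) y≡
      where
      h = proj₁ (halve (z₁ K.// z₂))
      mid : Midpoint (G ×ᴬ K) (g , z₁) (G.0# , h) (H.- (g , z₂))
      mid = cong₂ _,_ (trans (G.identityˡ G.0#) (sym (G.inverseʳ g))) (proj₂ (halve (z₁ K.// z₂)))
      y≡ : colour (H.- (g , z₂)) ≡ colour (g , z₂)
      y≡ = H.obstruction-colour-neg 𝒪 (g , z₂)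

    nonKColour? : Decidable (¬_ ∘ KColour)
    nonKColour? = ¬? ∘ KColour?

    rank : ℕ → ℕ
    rank = count nonKColour?

    -- Cosets {g} × K with g ≠ 0 meeting only axis colours get the junk colour suc (rank (p + q)).
    cosetColour : G.Carrier → ℕ
    cosetColour g with K.search (λ z → nonKColour? (colour (g , z)))
    ... | yes (z , _) = suc (rank (colour (g , z)))
    ... | no  _ with g G.≟ G.0#
    ...   | yes _ = 0
    ...   | no  _ = suc (rank (p + q))

    Witness : G.Carrier → K.Carrier → Set
    Witness g z = colour (g , z) ≡ 0 ⊎ ¬ KColour (colour (g , z))

    witness-or-junk : ∀ g → (∃ λ z → Witness g z) ⊎ cosetColour g ≡ suc (rank (p + q))
    witness-or-junk g with K.search (λ z → nonKColour? (colour (g , z)))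
    ... | yes (z , ¬K) = inj₁ (z , inj₂ ¬K)
    ... | no  _ with g G.≟ G.0#
    ...   | yes refl = inj₁ (K.0# , inj₁ colour-0#)
    ...   | no  _    = inj₂ refl

    cosetColour-nonK : ∀ {g z} → ¬ KColour (colour (g , z)) → cosetColour g ≡ suc (rank (colour (g , z)))
    cosetColour-nonK {g} {z} ¬K with K.search (λ z → nonKColour? (colour (g , z)))
    ... | yes (z′ , ¬K′) = cong (suc ∘ rank) (coset-colour-unique ¬K′ ¬K)
    ... | no  ∄          = contradiction (z , ¬K) ∄

    cosetColour-0# : cosetColour G.0# ≡ 0
    cosetColour-0# with K.search (λ z → nonKColour? (colour (G.0# , z)))
    ... | yes (z , ¬K) = contradiction (z , refl) ¬K
    ... | no  _ with G.0# G.≟ G.0#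
    ...   | yes _   = refl
    ...   | no  0≢0 = contradiction refl 0≢0

    cosetColour≡0⇒≡0# : ∀ {g} → cosetColour g ≡ 0 → g ≡ G.0#
    cosetColour≡0⇒≡0# {g} _ with K.search (λ z → nonKColour? (colour (g , z)))
    cosetColour≡0⇒≡0# {g} () | yes _
    cosetColour≡0⇒≡0# {g} _  | no  _ with g G.≟ G.0#
    cosetColour≡0⇒≡0# {g} _  | no  _ | yes g≡0# = g≡0#
    cosetColour≡0⇒≡0# {g} () | no  _ | no  _

    witness-separatesˡ : ∀ {g g′ z z′} → Witness g z → cosetColour g ≢ cosetColour g′ →
                         colour (g , z) ≢ colour (g′ , z′)
    witness-separatesˡ (inj₁ colour≡0) cosets≢ colours≡ =
      cosets≢ (cong (cosetColour ∘ proj₁) (trans (colour≡0⇒≡0# colour≡0)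
                                                 (sym (colour≡0⇒≡0# (trans (sym colours≡) colour≡0)))))
    witness-separatesˡ (inj₂ ¬K) cosets≢ colours≡ =
      cosets≢ (trans (cosetColour-nonK ¬K)
                     (trans (cong (suc ∘ rank) colours≡)
                            (sym (cosetColour-nonK (¬K ∘ subst KColour (sym colours≡))))))

    witness-separatesʳ : ∀ {g g′ z z′} → Witness g′ z′ → cosetColour g ≢ cosetColour g′ →
                         colour (g , z) ≢ colour (g′ , z′)
    witness-separatesʳ w cosets≢ = witness-separatesˡ w (cosets≢ ∘ sym) ∘ sym

    -- Two of the three cosets carry witnesses; the third K-coordinate completes a 3-AP.
    cosetColour-rainbowFree : RainbowFree G cosetColour
    cosetColour-rainbowFree {g₀} {g₁} {g₂} mid (d₀₁ , d₀₂ , d₁₂)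
      with witness-or-junk g₀ | witness-or-junk g₁ | witness-or-junk g₂
    ... | inj₂ j₀ | inj₂ j₁ | _       = d₀₁ (trans j₀ (sym j₁))
    ... | inj₂ j₀ | _       | inj₂ j₂ = d₀₂ (trans j₀ (sym j₂))
    ... | _       | inj₂ j₁ | inj₂ j₂ = d₁₂ (trans j₁ (sym j₂))
    ... | inj₁ (z₀ , w₀) | _ | inj₁ (z₂ , w₂) =
      let (h , h⊕h≡) = halve (z₀ K.⊕ z₂) in
      rainbowFree {_ , z₀} {_ , h} {_ , z₂} (cong₂ _,_ mid h⊕h≡)
        (witness-separatesˡ w₀ d₀₁ , witness-separatesˡ w₀ d₀₂ , witness-separatesʳ w₂ d₁₂)
    ... | inj₁ (z₀ , w₀) | inj₁ (z₁ , w₁) | inj₂ _ =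
      rainbowFree {_ , z₀} {_ , z₁} {_ , (z₁ K.⊕ z₁) K.// z₀} (cong₂ _,_ mid (sym (K.x⊕[y//x]≡y z₀ _)))
        (witness-separatesˡ w₀ d₀₁ , witness-separatesˡ w₀ d₀₂ , witness-separatesˡ w₁ d₁₂)
    ... | inj₂ _ | inj₁ (z₁ , w₁) | inj₁ (z₂ , w₂) =
      rainbowFree {_ , (z₁ K.⊕ z₁) K.// z₂} {_ , z₁} {_ , z₂} (cong₂ _,_ mid (sym (K.//-rightDividesˡ z₂ _)))
        (witness-separatesʳ w₁ d₀₁ , witness-separatesʳ w₂ d₀₂ , witness-separatesˡ w₁ d₁₂)

    coset-obstruction : p ≤ rank (p + q) → G.Obstruction (suc p)
    coset-obstruction p≤rank = record
      { colour = cosetColour ; colour-0# = cosetColour-0# ; colour≡0⇒≡0# = cosetColour≡0⇒≡0#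
      ; colour-onto = onto ; rainbowFree = cosetColour-rainbowFree }
      where
      onto : ∀ {t} → t < suc p → ∃ λ g → cosetColour g ≡ t
      onto {zero}  _          = G.0# , cosetColour-0#
      onto {suc i} (s≤s i<p) =
        let (y , y<p+q , ¬Ky , rank-y≡i) = count-surjective nonKColour? (p + q) (<-≤-trans i<p p≤rank)
            ((g , z) , colour-gz≡y)     = colour-onto y<p+q
        in g , trans (cosetColour-nonK (¬Ky ∘ subst KColour colour-gz≡y))
                     (cong suc (trans (cong rank colour-gz≡y) rank-y≡i))

    ×-obstruction-split : G.Obstruction (suc p) ⊎ K.Obstruction (suc q)
    ×-obstruction-split with suc q ≤? count KColour? (p + q)
    ... | yes 1+q≤count = inj₂ (axis-obstruction 1+q≤count)
    ... | no  1+q≰count = inj₁ (coset-obstruction (+-cancelʳ-≤ q p (rank (p + q)) (begin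
      p + q                                 ≡⟨ count-complement KColour? (p + q) ⟨
      count KColour? (p + q) + rank (p + q) ≤⟨ +-monoˡ-≤ (rank (p + q)) (s≤s⁻¹ (≰⇒> 1+q≰count)) ⟩
      q + rank (p + q)                      ≡⟨ +-comm q (rank (p + q)) ⟩
      rank (p + q) + q                      ∎)))
      where open ≤-Reasoning

  open ObstructionSplit public using (×-obstruction-split)

  awU-× : (∀ {x y} → x K.⊕ x ≡ y K.⊕ y → x ≡ y) → (∀ z → ∃ λ h → h K.⊕ h ≡ z) →
          ∀ {a b c} → AwU G 3 a → AwU K 3 b → AwU (G ×ᴬ K) 3 c → c + 2 ≡ a + b
  awU-× double-injective halve {suc (suc a)} {suc (suc b)} {suc (suc c)}
        awG@(s≤s (s≤s z≤n) , allRainbowG , _) awK@(s≤s (s≤s z≤n) , allRainbowK , _)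
        (s≤s (s≤s z≤n) , allRainbowH , minimalH) =
    cong (2 +_) (begin
      c + 2       ≡⟨ cong (_+ 2) (≤-antisym c≤a+b a+b≤c) ⟩
      a + b + 2   ≡⟨ +-assoc a b 2 ⟩
      a + (b + 2) ≡⟨ cong (a +_) (+-comm b 2) ⟩
      a + (2 + b) ∎)
    where
    open ≡-Reasoning
    c≤a+b : c ≤ a + b
    c≤a+b = ≮⇒≥ λ a+b<c → minimalH (suc (suc (a + b))) (s≤s (s≤s z≤n)) (s≤s (s≤s a+b<c))
      (H.¬obstruction⇒allRainbow λ 𝒪 →
        [ (λ 𝒢 → G.obstruction⇒¬allRainbow 𝒢 allRainbowG)
        , (λ 𝒦 → K.obstruction⇒¬allRainbow 𝒦 allRainbowK) ]′
        (×-obstruction-split halve (H.obstruction-mono (≤-reflexive (cong suc (+-suc a b))) 𝒪)))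
    a+b≤c : a + b ≤ c
    a+b≤c = ≮⇒≥ λ c<a+b → G.awU⇒¬¬obstruction awG λ 𝒢 → K.awU⇒¬¬obstruction awK λ 𝒦 →
      H.obstruction⇒¬allRainbow
        (H.obstruction-mono (s≤s c<a+b) (×-obstruction double-injective 𝒢 𝒦)) allRainbowH

-- The cyclic group ℤ_n

[m%n+o]%n≡[m+o]%n : ∀ m o n .{{_ : NonZero n}} → (m % n + o) % n ≡ (m + o) % n
[m%n+o]%n≡[m+o]%n m o n = begin
  (m % n + o) % n         ≡⟨ %-distribˡ-+ (m % n) o n ⟩
  (m % n % n + o % n) % n ≡⟨ cong (λ t → (t + o % n) % n) (m%n%n≡m%n m n) ⟩
  (m % n + o % n) % n     ≡⟨ %-distribˡ-+ m o n ⟨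
  (m + o) % n             ∎
  where open ≡-Reasoning

[m+o%n]%n≡[m+o]%n : ∀ m o n .{{_ : NonZero n}} → (m + o % n) % n ≡ (m + o) % n
[m+o%n]%n≡[m+o]%n m o n = begin
  (m + o % n) % n ≡⟨ cong (_% n) (+-comm m (o % n)) ⟩
  (o % n + m) % n ≡⟨ [m%n+o]%n≡[m+o]%n o m n ⟩
  (o + m) % n     ≡⟨ cong (_% n) (+-comm o m) ⟩
  (m + o) % n     ∎
  where open ≡-Reasoning

[m%n*o]%n≡[m*o]%n : ∀ m o n .{{_ : NonZero n}} → (m % n * o) % n ≡ (m * o) % n
[m%n*o]%n≡[m*o]%n m o n = begin
  (m % n * o) % n             ≡⟨ %-distribˡ-* (m % n) o n ⟩
  (m % n % n * (o % n)) % n   ≡⟨ cong (λ t → (t * (o % n)) % n) (m%n%n≡m%n m n) ⟩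
  (m % n * (o % n)) % n       ≡⟨ %-distribˡ-* m o n ⟨
  (m * o) % n                 ∎
  where open ≡-Reasoning

module _ {k : ℕ} where
  private
    n : ℕ
    n = suc k

  toℕ-+ₙ : ∀ (x y : Fin n) → toℕ (x +ₙ y) ≡ (toℕ x + toℕ y) % n
  toℕ-+ₙ x y = toℕ-fromℕ< _

  -ₙ_ : Fin n → Fin n
  -ₙ x = fromℕ< (m%n<n (n ∸ toℕ x) n)

  +ₙ-assoc : ∀ x y z → (x +ₙ y) +ₙ z ≡ x +ₙ (y +ₙ z)
  +ₙ-assoc x y z = toℕ-injective (begin
    toℕ ((x +ₙ y) +ₙ z)               ≡⟨ toℕ-+ₙ (x +ₙ y) z ⟩
    (toℕ (x +ₙ y) + toℕ z) % n        ≡⟨ cong (λ t → (t + toℕ z) % n) (toℕ-+ₙ x y) ⟩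
    ((toℕ x + toℕ y) % n + toℕ z) % n ≡⟨ [m%n+o]%n≡[m+o]%n (toℕ x + toℕ y) (toℕ z) n ⟩
    (toℕ x + toℕ y + toℕ z) % n       ≡⟨ cong (_% n) (+-assoc (toℕ x) (toℕ y) (toℕ z)) ⟩
    (toℕ x + (toℕ y + toℕ z)) % n     ≡⟨ [m+o%n]%n≡[m+o]%n (toℕ x) (toℕ y + toℕ z) n ⟨
    (toℕ x + (toℕ y + toℕ z) % n) % n ≡⟨ cong (λ t → (toℕ x + t) % n) (toℕ-+ₙ y z) ⟨
    (toℕ x + toℕ (y +ₙ z)) % n        ≡⟨ toℕ-+ₙ x (y +ₙ z) ⟨
    toℕ (x +ₙ (y +ₙ z))               ∎)
    where open ≡-Reasoning

  +ₙ-comm : ∀ x y → x +ₙ y ≡ y +ₙ x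
  +ₙ-comm x y = toℕ-injective (begin
    toℕ (x +ₙ y)          ≡⟨ toℕ-+ₙ x y ⟩
    (toℕ x + toℕ y) % n   ≡⟨ cong (_% n) (+-comm (toℕ x) (toℕ y)) ⟩
    (toℕ y + toℕ x) % n   ≡⟨ toℕ-+ₙ y x ⟨
    toℕ (y +ₙ x)          ∎)
    where open ≡-Reasoning

  +ₙ-identityˡ : ∀ x → Fin.zero +ₙ x ≡ x
  +ₙ-identityˡ x = toℕ-injective (trans (toℕ-+ₙ Fin.zero x) (m<n⇒m%n≡m (toℕ<n x)))

  +ₙ-inverseʳ : ∀ x → x +ₙ (-ₙ x) ≡ Fin.zero
  +ₙ-inverseʳ x = toℕ-injective (begin
    toℕ (x +ₙ (-ₙ x))             ≡⟨ toℕ-+ₙ x (-ₙ x) ⟩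
    (toℕ x + toℕ (-ₙ x)) % n      ≡⟨ cong (λ t → (toℕ x + t) % n) (toℕ-fromℕ< _) ⟩
    (toℕ x + (n ∸ toℕ x) % n) % n ≡⟨ [m+o%n]%n≡[m+o]%n (toℕ x) (n ∸ toℕ x) n ⟩
    (toℕ x + (n ∸ toℕ x)) % n     ≡⟨ cong (_% n) (m+[n∸m]≡n (<⇒≤ (toℕ<n x))) ⟩
    n % n                         ≡⟨ n%n≡0 n ⟩
    0                             ∎)
    where open ≡-Reasoning

  ℤ/-searchable : SearchableAbelianGroup (ℤ/ n)
  ℤ/-searchable = record
    { 0# = Fin.zero ; -_ = -ₙ_
    ; isAbelianGroup = isAbelianGroup-≡ +ₙ-assoc +ₙ-comm +ₙ-identityˡ +ₙ-inverseʳ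
    ; _≟_ = _≟ᶠ_ ; search = any? }

a*[1+m]+a*[1+m]≡a+a*[1+2m] : ∀ a m → a * suc m + a * suc m ≡ a + a * suc (2 * m)
a*[1+m]+a*[1+m]≡a+a*[1+2m] = solve-∀

module _ (m : ℕ) where
  private
    n : ℕ
    n = suc (2 * m)

  -- Halving is multiplication by m + 1, as 2 (m + 1) ≡ 1 modulo 2 m + 1.
  half : Fin n → Fin n
  half x = fromℕ< (m%n<n (toℕ x * suc m) n)

  private
    [x*[1+m]+x*[1+m]]%n≡x : ∀ (x : Fin n) → (toℕ x * suc m + toℕ x * suc m) % n ≡ toℕ x
    [x*[1+m]+x*[1+m]]%n≡x x = begin
      (toℕ x * suc m + toℕ x * suc m) % n ≡⟨ cong (_% n) (a*[1+m]+a*[1+m]≡a+a*[1+2m] (toℕ x) m) ⟩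
      (toℕ x + toℕ x * n) % n             ≡⟨ [m+kn]%n≡m%n (toℕ x) (toℕ x) n ⟩
      toℕ x % n                           ≡⟨ m<n⇒m%n≡m (toℕ<n x) ⟩
      toℕ x                               ∎
      where open ≡-Reasoning

  half+half : ∀ x → half x +ₙ half x ≡ x
  half+half x = toℕ-injective (begin
    toℕ (half x +ₙ half x)            ≡⟨ toℕ-+ₙ (half x) (half x) ⟩
    (toℕ (half x) + toℕ (half x)) % n ≡⟨ cong (λ t → (t + t) % n) (toℕ-fromℕ< (m%n<n x*[1+m] n)) ⟩
    (x*[1+m] % n + x*[1+m] % n) % n   ≡⟨ %-distribˡ-+ x*[1+m] x*[1+m] n ⟨
    (x*[1+m] + x*[1+m]) % n           ≡⟨ [x*[1+m]+x*[1+m]]%n≡x x ⟩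
    toℕ x                             ∎)
    where
    open ≡-Reasoning
    x*[1+m] = toℕ x * suc m

  half-double : ∀ x → half (x +ₙ x) ≡ x
  half-double x = toℕ-injective (begin
    toℕ (half (x +ₙ x))                 ≡⟨ toℕ-fromℕ< _ ⟩
    toℕ (x +ₙ x) * suc m % n            ≡⟨ cong (λ t → t * suc m % n) (toℕ-+ₙ x x) ⟩
    (toℕ x + toℕ x) % n * suc m % n     ≡⟨ [m%n*o]%n≡[m*o]%n (toℕ x + toℕ x) (suc m) n ⟩
    (toℕ x + toℕ x) * suc m % n         ≡⟨ cong (_% n) (*-distribʳ-+ (suc m) (toℕ x) (toℕ x)) ⟩
    (toℕ x * suc m + toℕ x * suc m) % n ≡⟨ [x*[1+m]+x*[1+m]]%n≡x x ⟩
    toℕ x                               ∎)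
    where open ≡-Reasoning

  ℤ/-halve : ∀ z → ∃ λ h → h +ₙ h ≡ z
  ℤ/-halve z = half z , half+half z

  ℤ/-double-injective : ∀ {x y : Fin n} → x +ₙ x ≡ y +ₙ y → x ≡ y
  ℤ/-double-injective {x} {y} x+x≡y+y = begin
    x              ≡⟨ half-double x ⟨
    half (x +ₙ x)  ≡⟨ cong half x+x≡y+y ⟩
    half (y +ₙ y)  ≡⟨ half-double y ⟩
    y              ∎
    where open ≡-Reasoning

theorem14 : (G : FiniteAbelianGroup) (m : ℕ) (a b c : ℕ)
    → AwU (toAddStr G) 3 a
    → AwU (ℤ/ (suc (2 * m))) 3 b
    → AwU (toAddStr G ×ᴬ ℤ/ (suc (2 * m))) 3 c
    → c + 2 ≡ a + b
theorem14 G m a b c =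
  awU-× (finiteAbelianGroup⇒searchable G) ℤ/-searchable (ℤ/-double-injective m) (ℤ/-halve m)
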